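{- The structure $\mathbf{Move}$ defined in the context is a strict $3$-category.
   Context: Let ${\tt M}$ be the free monoid of words on the letters ${\tt l},{\tt r},{\tt t}$, with the empty word $\epsilon$ as unit. Order ${\tt M}$ by $<_{\tt M}$ as follows: a shorter word is smaller; words of equal length are compared lexicographically, using the letter order ${\tt t}<{\tt r}<{\tt l}$. For $n\in\mathbb{N}$, order ${\tt M}^n$ by the product order. That is, $\vec x\le\vec y$ iff $x_i\le_{\tt M}y_i$ for all $i$, and $\vec x<_{{\tt M}^n}\vec y$ iff $\vec x\le\vec y$ and $\vec x\neq\vec y$. $\mathbf{Move}$ has the following cells. - A single $0$-cell $\ast$. - $1$-cells: the sets ${\tt M}^n$ for $n\in\mathbb{N}$. Here ${\tt M}^0$ is the identity $1$-cell on $\ast$, and ${\tt M}^n\star_0{\tt M}^m={\tt M}^{n+m}$. - $2$-cells from ${\tt M}^n$ to ${\tt M}^n$: the maps $f:{\tt M}^n\to{\tt M}^n$ that are strictly increasing with respect to $<_{{\tt M}^n}$. All identity maps are included. - $\star_0$ on $2$-cells is the cartesian product of maps, $f\times g$. - $\star_1$ on $2$-cells is composition, with $f\star_1 g=g\circ f$. - For $f,g:{\tt M}^n\to{\tt M}^n$, write $f<_2g$ iff $f(\vec x)<_{{\tt M}^n}g(\vec x)$ for all $\vec x$. Write $f\le_2 g$ iff $f=g$ or $f<_2 g$. - $3$-cells: the pairs $\langle f,g\rangle$ of $2$-cells with the same source and target such that $g\le_2 f$. The $2$-source of $\langle f,g\rangle$ is $f$, its $2$-target is $g$, and identity $3$-cells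 are the pairs $\langle f,f\rangle$. - $\langle f,g\rangle\star_0\langle f',g'\rangle=\langle f\times f',g\times g'\rangle$. - $\langle f,g\rangle\star_1\langle f',g'\rangle=\langle f'\circ f,g'\circ g\rangle$. - $\langle f,g\rangle\star_2\langle g,h\rangle=\langle f,h\rangle$. -}

module Defs where

open import Data.Nat using (ℕ; zero; suc; _+_) renaming (_<_ to _<ℕ_)
open import Data.Nat.Properties using (+-assoc; +-identityʳ)
open import Data.List using (List; []; _∷_; length)
open import Data.Vec using (Vec; []; _∷_; _++_; take; drop; cast)
open import Data.Vec.Relation.Binary.Pointwise.Inductive using (Pointwise)
open import Data.Product using (Σ; _×_; _,_; proj₁; proj₂)
open import Data.Sum using (_⊎_)
open import Relation.Binary.PropositionalEquality using (_≡_; _≢_)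
open import Function using (id; _∘_)

data Letter : Set where
  𝕥 𝕣 𝕝 : Letter

data _<L_ : Letter → Letter → Set where
  t<r : 𝕥 <L 𝕣
  t<l : 𝕥 <L 𝕝
  r<l : 𝕣 <L 𝕝

M : Set
M = List Letter   -- the empty word ε is []

data Lex< : M → M → Set where
  here  : ∀ {a b xs ys} → a <L b → Lex< (a ∷ xs) (b ∷ ys)
  there : ∀ {a xs ys} → Lex< xs ys → Lex< (a ∷ xs) (a ∷ ys)

_<M_ : M → M → Set
x <M y = (length x <ℕ length y) ⊎ ((length x ≡ length y) × Lex< x y)

_≤M_ : M → M → Set
x ≤M y = (x ≡ y) ⊎ (x <M y)

Mⁿ : ℕ → Set
Mⁿ n = Vec M n

_≤ⁿ_ : ∀ {n} → Mⁿ n → Mⁿ n → Set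
x ≤ⁿ y = Pointwise _≤M_ x y

_<ⁿ_ : ∀ {n} → Mⁿ n → Mⁿ n → Set
x <ⁿ y = (x ≤ⁿ y) × (x ≢ y)

Map : ℕ → Set
Map n = Mⁿ n → Mⁿ n

StrictlyIncreasing : ∀ {n} → Map n → Set
StrictlyIncreasing f = ∀ x y → x <ⁿ y → f x <ⁿ f y

Cell₂ : ℕ → Set
Cell₂ n = Σ (Map n) StrictlyIncreasing

_≐_ : ∀ {n} → Map n → Map n → Set
f ≐ g = ∀ x → f x ≡ g x

_≐⟨_⟩_ : ∀ {a b} → Map a → a ≡ b → Map b → Set
f ≐⟨ e ⟩ g = ∀ x → cast e (f x) ≡ g (cast e x)

_<₂_ : ∀ {n} → Map n → Map n → Set
f <₂ g = ∀ x → f x <ⁿ g x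

_≤₂_ : ∀ {n} → Map n → Map n → Set
f ≤₂ g = (f ≐ g) ⊎ (f <₂ g)

-- ⋆₀ : cartesian product of maps
_×₂_ : ∀ {n m} → Map n → Map m → Map (n + m)
_×₂_ {n} f g w = f (take n w) ++ g (drop n w)

_⋆₁_ : ∀ {n} → Map n → Map n → Map n
f ⋆₁ g = g ∘ f

id₂ : ∀ n → Map n
id₂ n = id

record Cell₃ (n : ℕ) : Set where
  constructor ⟨_,_⟩[_]
  field
    src₂ : Cell₂ n
    tgt₂ : Cell₂ n
    ok   : proj₁ tgt₂ ≤₂ proj₁ src₂
open Cell₃ public

-- raw 3-cells (pairs of maps), on which the compositions are defined
Pair : ℕ → Set
Pair n = Map n × Map n

raw : ∀ {n} → Cell₃ n → Pair n
raw α = proj₁ (src₂ α) , proj₁ (tgt₂ α)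

Is3Cell : ∀ {n} → Pair n → Set
Is3Cell (f , g) = StrictlyIncreasing f × StrictlyIncreasing g × (g ≤₂ f)

_≈₃_ : ∀ {n} → Pair n → Pair n → Set
(f , g) ≈₃ (f' , g') = (f ≐ f') × (g ≐ g')

_≈₃⟨_⟩_ : ∀ {a b} → Pair a → a ≡ b → Pair b → Set
(f , g) ≈₃⟨ e ⟩ (f' , g') = (f ≐⟨ e ⟩ f') × (g ≐⟨ e ⟩ g')

id₃ : ∀ {n} → Map n → Pair n
id₃ f = f , f

_⋆₀³_ : ∀ {n m} → Pair n → Pair m → Pair (n + m)
(f , g) ⋆₀³ (f' , g') = (f ×₂ f') , (g ×₂ g')

_⋆₁³_ : ∀ {n} → Pair n → Pair n → Pair n
(f , g) ⋆₁³ (f' , g') = (f ⋆₁ f') , (g ⋆₁ g')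

-- ⟨f,g⟩ ⋆₂ ⟨g,h⟩ = ⟨f,h⟩ (defined when the 2-target of α is the 2-source of β)
_⋆₂³_ : ∀ {n} → Pair n → Pair n → Pair n
(f , _) ⋆₂³ (_ , h) = f , h

_▹_ : ∀ {n} → Pair n → Pair n → Set
(_ , g) ▹ (g' , _) = g ≐ g'

-- The axioms of a strict 3-category, spelled out for Move.
-- There is a single 0-cell; 1-cells are the numbers n (standing for M^n),
-- with ⋆₀ = + and identity M^0.

record MoveIsStrict3Category : Set where
  field
    ⋆₀-assoc₁ : ∀ n m k → (n + m) + k ≡ n + (m + k)
    ⋆₀-unitˡ₁ : ∀ n → 0 + n ≡ n
    ⋆₀-unitʳ₁ : ∀ n → n + 0 ≡ n

    id₂-cell  : ∀ n → StrictlyIncreasing (id₂ n)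
    ⋆₀-cell₂  : ∀ {n m} (f : Cell₂ n) (g : Cell₂ m) →
                StrictlyIncreasing (proj₁ f ×₂ proj₁ g)
    ⋆₁-cell₂  : ∀ {n} (f g : Cell₂ n) → StrictlyIncreasing (proj₁ f ⋆₁ proj₁ g)
    ⋆₀-assoc₂ : ∀ {n m k} (f : Cell₂ n) (g : Cell₂ m) (h : Cell₂ k) →
                ((proj₁ f ×₂ proj₁ g) ×₂ proj₁ h)
                  ≐⟨ +-assoc n m k ⟩ (proj₁ f ×₂ (proj₁ g ×₂ proj₁ h))
    ⋆₁-assoc₂ : ∀ {n} (f g h : Cell₂ n) →
                ((proj₁ f ⋆₁ proj₁ g) ⋆₁ proj₁ h) ≐ (proj₁ f ⋆₁ (proj₁ g ⋆₁ proj₁ h))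
    -- 2-cells: units (identity of the 0-cell is id₂ 0; of the 1-cell M^n is id₂ n)
    ⋆₀-unitˡ₂ : ∀ {n} (f : Cell₂ n) → (id₂ 0 ×₂ proj₁ f) ≐ proj₁ f
    ⋆₀-unitʳ₂ : ∀ {n} (f : Cell₂ n) → (proj₁ f ×₂ id₂ 0) ≐⟨ +-identityʳ n ⟩ proj₁ f
    ⋆₁-unitˡ₂ : ∀ {n} (f : Cell₂ n) → (id₂ n ⋆₁ proj₁ f) ≐ proj₁ f
    ⋆₁-unitʳ₂ : ∀ {n} (f : Cell₂ n) → (proj₁ f ⋆₁ id₂ n) ≐ proj₁ f
    id₂-⋆₀    : ∀ n m → (id₂ n ×₂ id₂ m) ≐ id₂ (n + m)
    interchange₂-01 : ∀ {n m} (f g : Cell₂ n) (f' g' : Cell₂ m) →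
                ((proj₁ f ⋆₁ proj₁ g) ×₂ (proj₁ f' ⋆₁ proj₁ g'))
                  ≐ ((proj₁ f ×₂ proj₁ f') ⋆₁ (proj₁ g ×₂ proj₁ g'))

    id₃-cell  : ∀ {n} (f : Cell₂ n) → Is3Cell (id₃ (proj₁ f))
    ⋆₀-cell₃  : ∀ {n m} (α : Cell₃ n) (β : Cell₃ m) → Is3Cell (raw α ⋆₀³ raw β)
    ⋆₁-cell₃  : ∀ {n} (α β : Cell₃ n) → Is3Cell (raw α ⋆₁³ raw β)
    ⋆₂-cell₃  : ∀ {n} (α β : Cell₃ n) → raw α ▹ raw β → Is3Cell (raw α ⋆₂³ raw β)
    ⋆₀-assoc₃ : ∀ {n m k} (α : Cell₃ n) (β : Cell₃ m) (γ : Cell₃ k) →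
                ((raw α ⋆₀³ raw β) ⋆₀³ raw γ)
                  ≈₃⟨ +-assoc n m k ⟩ (raw α ⋆₀³ (raw β ⋆₀³ raw γ))
    ⋆₁-assoc₃ : ∀ {n} (α β γ : Cell₃ n) →
                ((raw α ⋆₁³ raw β) ⋆₁³ raw γ) ≈₃ (raw α ⋆₁³ (raw β ⋆₁³ raw γ))
    ⋆₂-assoc₃ : ∀ {n} (α β γ : Cell₃ n) → raw α ▹ raw β → raw β ▹ raw γ →
                ((raw α ⋆₂³ raw β) ⋆₂³ raw γ) ≈₃ (raw α ⋆₂³ (raw β ⋆₂³ raw γ))
    ⋆₀-unitˡ₃ : ∀ {n} (α : Cell₃ n) → (id₃ (id₂ 0) ⋆₀³ raw α) ≈₃ raw α
    ⋆₀-unitʳ₃ : ∀ {n} (α : Cell₃ n) →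
                (raw α ⋆₀³ id₃ (id₂ 0)) ≈₃⟨ +-identityʳ n ⟩ raw α
    ⋆₁-unitˡ₃ : ∀ {n} (α : Cell₃ n) → (id₃ (id₂ n) ⋆₁³ raw α) ≈₃ raw α
    ⋆₁-unitʳ₃ : ∀ {n} (α : Cell₃ n) → (raw α ⋆₁³ id₃ (id₂ n)) ≈₃ raw α
    ⋆₂-unitˡ₃ : ∀ {n} (α : Cell₃ n) → (id₃ (proj₁ (raw α)) ⋆₂³ raw α) ≈₃ raw α
    ⋆₂-unitʳ₃ : ∀ {n} (α : Cell₃ n) → (raw α ⋆₂³ id₃ (proj₂ (raw α))) ≈₃ raw α
    id₃-⋆₀    : ∀ {n m} (f : Cell₂ n) (g : Cell₂ m) →
                (id₃ (proj₁ f) ⋆₀³ id₃ (proj₁ g)) ≈₃ id₃ (proj₁ f ×₂ proj₁ g)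
    id₃-⋆₁    : ∀ {n} (f g : Cell₂ n) →
                (id₃ (proj₁ f) ⋆₁³ id₃ (proj₁ g)) ≈₃ id₃ (proj₁ f ⋆₁ proj₁ g)
    interchange₃-01 : ∀ {n m} (α β : Cell₃ n) (γ δ : Cell₃ m) →
                ((raw α ⋆₁³ raw β) ⋆₀³ (raw γ ⋆₁³ raw δ))
                  ≈₃ ((raw α ⋆₀³ raw γ) ⋆₁³ (raw β ⋆₀³ raw δ))
    interchange₃-02 : ∀ {n m} (α β : Cell₃ n) (γ δ : Cell₃ m) →
                raw α ▹ raw β → raw γ ▹ raw δ →
                ((raw α ⋆₂³ raw β) ⋆₀³ (raw γ ⋆₂³ raw δ))
                  ≈₃ ((raw α ⋆₀³ raw γ) ⋆₂³ (raw β ⋆₀³ raw δ))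
    interchange₃-12 : ∀ {n} (α β γ δ : Cell₃ n) →
                raw α ▹ raw β → raw γ ▹ raw δ →
                ((raw α ⋆₂³ raw β) ⋆₁³ (raw γ ⋆₂³ raw δ))
                  ≈₃ ((raw α ⋆₁³ raw γ) ⋆₂³ (raw β ⋆₁³ raw δ))

{-# OPTIONS --safe #-}
-- The equational axioms hold pointwise, most of them definitionally: ⋆₁ is composition, ⋆₂
-- forgets the middle 2-cell, and ⋆₀ acts separately on the two halves of a vector, so the others
-- follow from take n (a ++ b) ≡ a and drop n (a ++ b) ≡ b, up to a cast along
-- n + m + k ≡ n + (m + k) or n + 0 ≡ n.
-- The content is the closure of the cells under the compositions. Since Mⁿ has decidable
-- equality, a strictly increasing map is monotone, and x <ⁿ y is a strict increase of the first
-- n or of the remaining coordinates; hence products of strictly increasing maps are strictly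
-- increasing. Finally ≤₂ is transitive and preserved by products and by pre- and postcomposition
-- with strictly increasing maps, which closes the 3-cells under ⋆₀, ⋆₁ and ⋆₂.
module Submission where

open import Defs
open import Level using (0ℓ)
open import Data.Nat using (ℕ; zero; suc; _+_)
import Data.Nat.Properties as ℕ
import Data.List.Properties as List
open import Data.Vec using (Vec; []; _∷_; _++_; take; drop; cast)
import Data.Vec.Properties as Vec
open import Data.Vec.Relation.Binary.Pointwise.Inductive as Pointwise
  using (Pointwise; []; _∷_; ++⁺)
open import Data.Product using (_×_; _,_; proj₁; proj₂; ∃₂; uncurry)
open import Data.Sum as Sum using (_⊎_; inj₁; inj₂)
open import Data.Empty using (⊥-elim)
open import Relation.Nullary using (¬_; yes; no)
open import Relation.Binary using (Rel; Transitive; IsPartialOrder; DecidableEquality)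
import Relation.Binary.Construct.NonStrictToStrict as NonStrictToStrict
open import Relation.Binary.PropositionalEquality
  using (_≡_; refl; sym; trans; cong; cong₂; subst; isEquivalence; module ≡-Reasoning)
open import Function using (_∘_)

<L-trans : Transitive _<L_
<L-trans t<r r<l = t<l

<L-irrefl : ∀ {a} → ¬ a <L a
<L-irrefl ()

Lex<-trans : Transitive Lex<
Lex<-trans (here a<b) (here b<c) = here (<L-trans a<b b<c)
Lex<-trans (here a<b) (there _)  = here a<b
Lex<-trans (there _)  (here b<c) = here b<c
Lex<-trans (there p)  (there q)  = there (Lex<-trans p q)

Lex<-irrefl : ∀ {x} → ¬ Lex< x x
Lex<-irrefl (here a<a) = <L-irrefl a<a
Lex<-irrefl (there p)  = Lex<-irrefl p

<M-trans : Transitive _<M_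
<M-trans (inj₁ p)       (inj₁ q)        = inj₁ (ℕ.<-trans p q)
<M-trans (inj₁ p)       (inj₂ (e , _))  = inj₁ (ℕ.<-≤-trans p (ℕ.≤-reflexive e))
<M-trans (inj₂ (e , _)) (inj₁ q)        = inj₁ (ℕ.≤-<-trans (ℕ.≤-reflexive e) q)
<M-trans (inj₂ (e , p)) (inj₂ (e′ , q)) = inj₂ (trans e e′ , Lex<-trans p q)

<M-irrefl : ∀ {x} → ¬ x <M x
<M-irrefl (inj₁ p)       = ℕ.<-irrefl refl p
<M-irrefl (inj₂ (_ , p)) = Lex<-irrefl p

module _ {A : Set} {_<_ : Rel A 0ℓ} (<-trans : Transitive _<_) (<-irrefl : ∀ {x} → ¬ x < x) where

  ≡⊎<-isPartialOrder : IsPartialOrder _≡_ (λ x y → x ≡ y ⊎ x < y)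
  ≡⊎<-isPartialOrder = record
    { isPreorder = record { isEquivalence = isEquivalence ; reflexive = inj₁ ; trans = ≤-trans }
    ; antisym    = ≤-antisym
    }
    where
    ≤-trans : ∀ {x y z} → x ≡ y ⊎ x < y → y ≡ z ⊎ y < z → x ≡ z ⊎ x < z
    ≤-trans (inj₁ refl) q           = q
    ≤-trans (inj₂ p)    (inj₁ refl) = inj₂ p
    ≤-trans (inj₂ p)    (inj₂ q)    = inj₂ (<-trans p q)

    ≤-antisym : ∀ {x y} → x ≡ y ⊎ x < y → y ≡ x ⊎ y < x → x ≡ y
    ≤-antisym (inj₁ e) _        = e
    ≤-antisym (inj₂ _) (inj₁ e) = sym e
    ≤-antisym (inj₂ p) (inj₂ q) = ⊥-elim (<-irrefl (<-trans p q))

module _ {A : Set} {_≤_ : Rel A 0ℓ} (po : IsPartialOrder _≡_ _≤_) where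
  open IsPartialOrder po using (antisym) renaming (refl to ≤-refl; trans to ≤-trans)

  Pointwise-antisym : ∀ {n} {x y : Vec A n} → Pointwise _≤_ x y → Pointwise _≤_ y x → x ≡ y
  Pointwise-antisym []       []       = refl
  Pointwise-antisym (p ∷ ps) (q ∷ qs) = cong₂ _∷_ (antisym p q) (Pointwise-antisym ps qs)

  Pointwise-isPartialOrder : ∀ n → IsPartialOrder {A = Vec A n} _≡_ (Pointwise _≤_)
  Pointwise-isPartialOrder n = record
    { isPreorder = record
      { isEquivalence = isEquivalence
      ; reflexive     = λ { refl → Pointwise.refl ≤-refl }
      ; trans         = Pointwise.trans ≤-trans
      }
    ; antisym = Pointwise-antisym
    }

≤ⁿ-isPartialOrder : ∀ n → IsPartialOrder _≡_ (_≤ⁿ_ {n})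
≤ⁿ-isPartialOrder = Pointwise-isPartialOrder (≡⊎<-isPartialOrder <M-trans <M-irrefl)

module _ {n : ℕ} where
  open IsPartialOrder (≤ⁿ-isPartialOrder n) public
    using (≤-respˡ-≈; ≤-respʳ-≈)
    renaming (refl to ≤ⁿ-refl; reflexive to ≤ⁿ-reflexive; trans to ≤ⁿ-trans; antisym to ≤ⁿ-antisym)
  open NonStrictToStrict _≡_ (_≤ⁿ_ {n})

  <ⁿ-≤ⁿ-trans : ∀ {x y z : Mⁿ n} → x <ⁿ y → y ≤ⁿ z → x <ⁿ z
  <ⁿ-≤ⁿ-trans = <-≤-trans sym ≤ⁿ-trans ≤ⁿ-antisym ≤-respʳ-≈

  ≤ⁿ-<ⁿ-trans : ∀ {x y z : Mⁿ n} → x ≤ⁿ y → y <ⁿ z → x <ⁿ z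
  ≤ⁿ-<ⁿ-trans = ≤-<-trans ≤ⁿ-trans ≤ⁿ-antisym ≤-respˡ-≈

_≟L_ : DecidableEquality Letter
𝕥 ≟L 𝕥 = yes refl
𝕥 ≟L 𝕣 = no λ ()
𝕥 ≟L 𝕝 = no λ ()
𝕣 ≟L 𝕥 = no λ ()
𝕣 ≟L 𝕣 = yes refl
𝕣 ≟L 𝕝 = no λ ()
𝕝 ≟L 𝕥 = no λ ()
𝕝 ≟L 𝕣 = no λ ()
𝕝 ≟L 𝕝 = yes refl

_≟ⁿ_ : ∀ {n} → DecidableEquality (Mⁿ n)
_≟ⁿ_ = Vec.≡-dec (List.≡-dec _≟L_)

≤ⁿ⇒≡⊎<ⁿ : ∀ {n} {x y : Mⁿ n} → x ≤ⁿ y → x ≡ y ⊎ x <ⁿ y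
≤ⁿ⇒≡⊎<ⁿ {x = x} {y} x≤y with x ≟ⁿ y
... | yes x≡y = inj₁ x≡y
... | no  x≢y = inj₂ (x≤y , x≢y)

strictlyIncreasing⇒monotone : ∀ {n} {f : Map n} → StrictlyIncreasing f →
                              ∀ {x y} → x ≤ⁿ y → f x ≤ⁿ f y
strictlyIncreasing⇒monotone sf x≤y with ≤ⁿ⇒≡⊎<ⁿ x≤y
... | inj₁ refl = ≤ⁿ-refl
... | inj₂ x<y  = proj₁ (sf _ _ x<y)

module _ {A : Set} {R : Rel A 0ℓ} where

  Pointwise-take : ∀ n {m} {x y : Vec A (n + m)} → Pointwise R x y →
                   Pointwise R (take n x) (take n y)
  Pointwise-take zero    _        = []
  Pointwise-take (suc n) (r ∷ rs) = r ∷ Pointwise-take n rs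

  Pointwise-drop : ∀ n {m} {x y : Vec A (n + m)} → Pointwise R x y →
                   Pointwise R (drop n x) (drop n y)
  Pointwise-drop zero    rs       = rs
  Pointwise-drop (suc n) (_ ∷ rs) = Pointwise-drop n rs

module _ {A : Set} where

  -- Unlike splitAt, this view can be matched with `with' in goals mentioning take n w or
  -- drop n w: those unfold to projections of splitAt n w, which `with' would abstract too.
  ++-view : ∀ n {m} (w : Vec A (n + m)) → ∃₂ λ a b → w ≡ a ++ b
  ++-view n w = take n w , drop n w , sym (Vec.take++drop≡id n w)

++-mono-<ⁿ : ∀ {n m} {a c : Mⁿ n} {b d : Mⁿ m} → a ≤ⁿ c → b ≤ⁿ d → a <ⁿ c ⊎ b <ⁿ d →
             (a ++ b) <ⁿ (c ++ d)
++-mono-<ⁿ {a = a} {c} a≤c b≤d (inj₁ (_ , a≢c)) = ++⁺ a≤c b≤d , a≢c ∘ Vec.++-injectiveˡ a c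
++-mono-<ⁿ {a = a} {c} a≤c b≤d (inj₂ (_ , b≢d)) = ++⁺ a≤c b≤d , b≢d ∘ Vec.++-injectiveʳ a c

take-<ⁿ⊎drop-<ⁿ : ∀ n {m} {x y : Mⁿ (n + m)} → x <ⁿ y → take n x <ⁿ take n y ⊎ drop n x <ⁿ drop n y
take-<ⁿ⊎drop-<ⁿ n {x = x} {y} (x≤y , x≢y) with take n x ≟ⁿ take n y
... | no  tx≢ty = inj₁ (Pointwise-take n x≤y , tx≢ty)
... | yes tx≡ty = inj₂ (Pointwise-drop n x≤y , λ dx≡dy → x≢y (begin
      x                       ≡⟨ Vec.take++drop≡id n x ⟨
      take n x ++ drop n x    ≡⟨ cong₂ _++_ tx≡ty dx≡dy ⟩
      take n y ++ drop n y    ≡⟨ Vec.take++drop≡id n y ⟩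
      y                       ∎))
  where open ≡-Reasoning

×₂-++ : ∀ {n m} (f : Map n) (g : Map m) a b → (f ×₂ g) (a ++ b) ≡ f a ++ g b
×₂-++ {n} f g a b = uncurry (cong₂ (λ u v → f u ++ g v))
  (Vec.++-injective (take n (a ++ b)) a (Vec.take++drop≡id n (a ++ b)))

×₂-assoc : ∀ {n m k} (f : Map n) (g : Map m) (h : Map k) →
           ((f ×₂ g) ×₂ h) ≐⟨ ℕ.+-assoc n m k ⟩ (f ×₂ (g ×₂ h))
×₂-assoc {n} {m} {k} f g h w with ++-view (n + m) w
... | ab , c , refl with ++-view n ab
... | a , b , refl = begin
  cast e (((f ×₂ g) ×₂ h) ((a ++ b) ++ c))  ≡⟨ cong (cast e) (×₂-++ (f ×₂ g) h (a ++ b) c) ⟩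
  cast e ((f ×₂ g) (a ++ b) ++ h c)         ≡⟨ cong (λ u → cast e (u ++ h c)) (×₂-++ f g a b) ⟩
  cast e ((f a ++ g b) ++ h c)              ≡⟨ Vec.++-assoc-eqFree (f a) (g b) (h c) ⟩
  f a ++ (g b ++ h c)                       ≡⟨ cong (f a ++_) (×₂-++ g h b c) ⟨
  f a ++ (g ×₂ h) (b ++ c)                  ≡⟨ ×₂-++ f (g ×₂ h) a (b ++ c) ⟨
  (f ×₂ (g ×₂ h)) (a ++ (b ++ c))           ≡⟨ cong (f ×₂ (g ×₂ h)) (Vec.++-assoc-eqFree a b c) ⟨
  (f ×₂ (g ×₂ h)) (cast e ((a ++ b) ++ c))  ∎
  where
  open ≡-Reasoning
  e = ℕ.+-assoc n m k

×₂-identityʳ : ∀ {n} (f : Map n) → (f ×₂ id₂ 0) ≐⟨ ℕ.+-identityʳ n ⟩ f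
×₂-identityʳ {n} f w with ++-view n w
... | a , [] , refl = begin
  cast e ((f ×₂ id₂ 0) (a ++ []))  ≡⟨ cong (cast e) (×₂-++ f (id₂ 0) a []) ⟩
  cast e (f a ++ [])               ≡⟨ Vec.++-identityʳ-eqFree (f a) ⟩
  f a                              ≡⟨ cong f (Vec.++-identityʳ-eqFree a) ⟨
  f (cast e (a ++ []))             ∎
  where
  open ≡-Reasoning
  e = ℕ.+-identityʳ n

×₂-⋆₁-interchange : ∀ {n m} (f g : Map n) (f′ g′ : Map m) →
                    ((f ⋆₁ g) ×₂ (f′ ⋆₁ g′)) ≐ ((f ×₂ f′) ⋆₁ (g ×₂ g′))
×₂-⋆₁-interchange {n} f g f′ g′ w = sym (×₂-++ g g′ (f (take n w)) (f′ (drop n w)))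

⋆₁-strictlyIncreasing : ∀ {n} {f g : Map n} → StrictlyIncreasing f → StrictlyIncreasing g →
                        StrictlyIncreasing (f ⋆₁ g)
⋆₁-strictlyIncreasing sf sg x y x<y = sg _ _ (sf x y x<y)

×₂-strictlyIncreasing : ∀ {n m} {f : Map n} {g : Map m} →
                        StrictlyIncreasing f → StrictlyIncreasing g →
                        StrictlyIncreasing (f ×₂ g)
×₂-strictlyIncreasing {n} sf sg x y x<y =
  ++-mono-<ⁿ (strictlyIncreasing⇒monotone sf (Pointwise-take n (proj₁ x<y)))
             (strictlyIncreasing⇒monotone sg (Pointwise-drop n (proj₁ x<y)))
             (Sum.map (sf _ _) (sg _ _) (take-<ⁿ⊎drop-<ⁿ n x<y))

≤₂⇒≤ⁿ : ∀ {n} {g f : Map n} → g ≤₂ f → ∀ x → g x ≤ⁿ f x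
≤₂⇒≤ⁿ (inj₁ g≐f) x = ≤ⁿ-reflexive (g≐f x)
≤₂⇒≤ⁿ (inj₂ g<f) x = proj₁ (g<f x)

≤₂-trans : ∀ {n} {h g f : Map n} → h ≤₂ g → g ≤₂ f → h ≤₂ f
≤₂-trans (inj₁ h≐g) (inj₁ g≐f) = inj₁ λ x → trans (h≐g x) (g≐f x)
≤₂-trans h≤g        (inj₂ g<f) = inj₂ λ x → ≤ⁿ-<ⁿ-trans (≤₂⇒≤ⁿ h≤g x) (g<f x)
≤₂-trans (inj₂ h<g) g≤f        = inj₂ λ x → <ⁿ-≤ⁿ-trans (h<g x) (≤₂⇒≤ⁿ g≤f x)

≤₂-respʳ-≐ : ∀ {n} {h g g′ : Map n} → g ≐ g′ → h ≤₂ g → h ≤₂ g′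
≤₂-respʳ-≐ g≐g′ (inj₁ h≐g) = inj₁ λ x → trans (h≐g x) (g≐g′ x)
≤₂-respʳ-≐ g≐g′ (inj₂ h<g) = inj₂ λ x → subst (_ <ⁿ_) (g≐g′ x) (h<g x)

⋆₁-monoˡ-≤₂ : ∀ {n} {g f h : Map n} → StrictlyIncreasing h → g ≤₂ f → (g ⋆₁ h) ≤₂ (f ⋆₁ h)
⋆₁-monoˡ-≤₂ {h = h} sh (inj₁ g≐f) = inj₁ (cong h ∘ g≐f)
⋆₁-monoˡ-≤₂         sh (inj₂ g<f) = inj₂ λ x → sh _ _ (g<f x)

⋆₁-monoʳ-≤₂ : ∀ {n} {k g f : Map n} → g ≤₂ f → (k ⋆₁ g) ≤₂ (k ⋆₁ f)
⋆₁-monoʳ-≤₂ {k = k} (inj₁ g≐f) = inj₁ (g≐f ∘ k)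
⋆₁-monoʳ-≤₂ {k = k} (inj₂ g<f) = inj₂ (g<f ∘ k)

×₂-monoˡ-≤₂ : ∀ {n m} {g f : Map n} {h : Map m} → g ≤₂ f → (g ×₂ h) ≤₂ (f ×₂ h)
×₂-monoˡ-≤₂ {n} {h = h} (inj₁ g≐f) = inj₁ λ w → cong (_++ h (drop n w)) (g≐f (take n w))
×₂-monoˡ-≤₂ {n}         (inj₂ g<f) = inj₂ λ w →
  ++-mono-<ⁿ (proj₁ (g<f (take n w))) ≤ⁿ-refl (inj₁ (g<f (take n w)))

×₂-monoʳ-≤₂ : ∀ {n m} {k : Map n} {g f : Map m} → g ≤₂ f → (k ×₂ g) ≤₂ (k ×₂ f)
×₂-monoʳ-≤₂ {n} {k = k} (inj₁ g≐f) = inj₁ λ w → cong (k (take n w) ++_) (g≐f (drop n w))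
×₂-monoʳ-≤₂ {n}         (inj₂ g<f) = inj₂ λ w →
  ++-mono-<ⁿ ≤ⁿ-refl (proj₁ (g<f (drop n w))) (inj₂ (g<f (drop n w)))

is3Cell : ∀ {n} (α : Cell₃ n) → Is3Cell (raw α)
is3Cell ⟨ (_ , sf) , (_ , sg) ⟩[ g≤f ] = sf , sg , g≤f

id₃-is3Cell : ∀ {n} {f : Map n} → StrictlyIncreasing f → Is3Cell (id₃ f)
id₃-is3Cell sf = sf , sf , inj₁ λ _ → refl

⋆₀³-is3Cell : ∀ {n m} {f g : Map n} {f′ g′ : Map m} → Is3Cell (f , g) → Is3Cell (f′ , g′) →
              Is3Cell ((f , g) ⋆₀³ (f′ , g′))
⋆₀³-is3Cell {f = f} {g′ = g′} (sf , sg , g≤f) (sf′ , sg′ , g′≤f′) =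
  ×₂-strictlyIncreasing sf sf′ , ×₂-strictlyIncreasing sg sg′ ,
  ≤₂-trans (×₂-monoˡ-≤₂ {h = g′} g≤f) (×₂-monoʳ-≤₂ {k = f} g′≤f′)

⋆₁³-is3Cell : ∀ {n} {f g f′ g′ : Map n} → Is3Cell (f , g) → Is3Cell (f′ , g′) →
              Is3Cell ((f , g) ⋆₁³ (f′ , g′))
⋆₁³-is3Cell (sf , sg , g≤f) (sf′ , sg′ , g′≤f′) =
  ⋆₁-strictlyIncreasing sf sf′ , ⋆₁-strictlyIncreasing sg sg′ ,
  ≤₂-trans (⋆₁-monoˡ-≤₂ sg′ g≤f) (⋆₁-monoʳ-≤₂ g′≤f′)

⋆₂³-is3Cell : ∀ {n} {f g g′ h : Map n} → Is3Cell (f , g) → Is3Cell (g′ , h) → (f , g) ▹ (g′ , h) →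
              Is3Cell ((f , g) ⋆₂³ (g′ , h))
⋆₂³-is3Cell (sf , _ , g≤f) (_ , sh , h≤g′) g≐g′ =
  sf , sh , ≤₂-trans (≤₂-respʳ-≐ (sym ∘ g≐g′) h≤g′) g≤f

⋆₀³-assoc : ∀ {n m k} (p : Pair n) (q : Pair m) (r : Pair k) →
            ((p ⋆₀³ q) ⋆₀³ r) ≈₃⟨ ℕ.+-assoc n m k ⟩ (p ⋆₀³ (q ⋆₀³ r))
⋆₀³-assoc (f , g) (f′ , g′) (f″ , g″) = ×₂-assoc f f′ f″ , ×₂-assoc g g′ g″

⋆₀³-identityʳ : ∀ {n} (p : Pair n) → (p ⋆₀³ id₃ (id₂ 0)) ≈₃⟨ ℕ.+-identityʳ n ⟩ p
⋆₀³-identityʳ (f , g) = ×₂-identityʳ f , ×₂-identityʳ g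

⋆₀³-⋆₁³-interchange : ∀ {n m} (p q : Pair n) (p′ q′ : Pair m) →
                      ((p ⋆₁³ q) ⋆₀³ (p′ ⋆₁³ q′)) ≈₃ ((p ⋆₀³ p′) ⋆₁³ (q ⋆₀³ q′))
⋆₀³-⋆₁³-interchange (f , g) (f′ , g′) (f″ , g″) (f‴ , g‴) =
  ×₂-⋆₁-interchange f f′ f″ f‴ , ×₂-⋆₁-interchange g g′ g″ g‴

≈₃-refl : ∀ {n} {f g : Map n} → (f , g) ≈₃ (f , g)
≈₃-refl = (λ _ → refl) , (λ _ → refl)

proposition1 : MoveIsStrict3Category
proposition1 = record
  { ⋆₀-assoc₁       = ℕ.+-assoc
  ; ⋆₀-unitˡ₁       = λ _ → refl
  ; ⋆₀-unitʳ₁       = ℕ.+-identityʳ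
  ; id₂-cell        = λ _ _ _ x<y → x<y
  ; ⋆₀-cell₂        = λ f g → ×₂-strictlyIncreasing (proj₂ f) (proj₂ g)
  ; ⋆₁-cell₂        = λ f g → ⋆₁-strictlyIncreasing (proj₂ f) (proj₂ g)
  ; ⋆₀-assoc₂       = λ f g h → ×₂-assoc (proj₁ f) (proj₁ g) (proj₁ h)
  ; ⋆₁-assoc₂       = λ _ _ _ _ → refl
  ; ⋆₀-unitˡ₂       = λ _ _ → refl
  ; ⋆₀-unitʳ₂       = λ f → ×₂-identityʳ (proj₁ f)
  ; ⋆₁-unitˡ₂       = λ _ _ → refl
  ; ⋆₁-unitʳ₂       = λ _ _ → refl
  ; id₂-⋆₀          = λ n _ → Vec.take++drop≡id n
  ; interchange₂-01 = λ f g f′ g′ → ×₂-⋆₁-interchange (proj₁ f) (proj₁ g) (proj₁ f′) (proj₁ g′)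
  ; id₃-cell        = λ f → id₃-is3Cell (proj₂ f)
  ; ⋆₀-cell₃        = λ α β → ⋆₀³-is3Cell (is3Cell α) (is3Cell β)
  ; ⋆₁-cell₃        = λ α β → ⋆₁³-is3Cell (is3Cell α) (is3Cell β)
  ; ⋆₂-cell₃        = λ α β → ⋆₂³-is3Cell (is3Cell α) (is3Cell β)
  ; ⋆₀-assoc₃       = λ α β γ → ⋆₀³-assoc (raw α) (raw β) (raw γ)
  ; ⋆₁-assoc₃       = λ _ _ _ → ≈₃-refl
  ; ⋆₂-assoc₃       = λ _ _ _ _ _ → ≈₃-refl
  ; ⋆₀-unitˡ₃       = λ _ → ≈₃-refl
  ; ⋆₀-unitʳ₃       = λ α → ⋆₀³-identityʳ (raw α)
  ; ⋆₁-unitˡ₃       = λ _ → ≈₃-refl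
  ; ⋆₁-unitʳ₃       = λ _ → ≈₃-refl
  ; ⋆₂-unitˡ₃       = λ _ → ≈₃-refl
  ; ⋆₂-unitʳ₃       = λ _ → ≈₃-refl
  ; id₃-⋆₀          = λ _ _ → ≈₃-refl
  ; id₃-⋆₁          = λ _ _ → ≈₃-refl
  ; interchange₃-01 = λ α β γ δ → ⋆₀³-⋆₁³-interchange (raw α) (raw β) (raw γ) (raw δ)
  ; interchange₃-02 = λ _ _ _ _ _ _ → ≈₃-refl
  ; interchange₃-12 = λ _ _ _ _ _ _ → ≈₃-refl
  }
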